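{- Let $H$ be a connected interval $d$-uniform hypergraph ($d\ge 2$) on vertex set $[n]$. Then every set of $d$ consecutive vertices $\{k,k+1,\dots,k+d-1\}\subseteq[n]$ is a zero forcing set for $H$.
   Context: An interval $d$-hypergraph here has vertex set $[n]$ and every edge is of the form $\{\ell,\ell+1,\dots,\ell+d-1\}$ for some $\ell\in\{1,\dots,n-d+1\}$. A path in a hypergraph is an alternating sequence $v_1,e_1,v_2,\dots,e_s,v_{s+1}$ of distinct vertices and distinct edges with $v_i,v_{i+1}\in e_i$; the hypergraph is connected if any two vertices are joined by a path. Zero forcing: with a set $B$ initially blue and the other vertices white, a set $S$ of $d-1$ distinct vertices (not necessarily blue) can turn a white vertex $w$ blue if $S\cup\{w\}$ is an edge and every white vertex $u$ such that $S\cup\{u\}$ is an edge satisfies $u=w$. $B$ is a zero forcing set if repeated application of this rule colors every vertex blue. -}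

module Defs where

open import Level using (Level) renaming (suc to lsuc; zero to lzero)
open import Data.Nat using (ℕ; _+_; _∸_; _≤_; _<_)
open import Data.List using (List; []; _∷_; length)
open import Data.List.Membership.Propositional using (_∈_)
open import Data.List.Relation.Unary.Unique.Propositional using (Unique)
open import Data.Product using (Σ; ∃; _×_; _,_)
open import Data.Sum using (_⊎_)
open import Relation.Nullary using (¬_)
open import Relation.Binary.PropositionalEquality using (_≡_)
open import Relation.Binary.Construct.Closure.ReflexiveTransitive using (Star)
open import Function.Bundles using (_⇔_)

Vertex : ℕ → ℕ → Set
Vertex n v = 1 ≤ v × v ≤ n

Interval : ℕ → ℕ → ℕ → Set
Interval d ℓ x = ℓ ≤ x × x < ℓ + d

-- An interval d-hypergraph on [n]: its edges are given by their starting
-- points ℓ ∈ {1,…,n-d+1}; `Edge ℓ` means {ℓ,…,ℓ+d-1} is an edge.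
record IntervalHypergraph : Set₁ where
  field
    n     : ℕ
    d     : ℕ
    Edge  : ℕ → Set
    valid : ∀ ℓ → Edge ℓ → 1 ≤ ℓ × ℓ ≤ n + 1 ∸ d

module _ (H : IntervalHypergraph) where
  open IntervalHypergraph H

  InEdge : ℕ → ℕ → Set
  InEdge ℓ x = Interval d ℓ x

  data Walk : ℕ → ℕ → List ℕ → List ℕ → Set where
    here : ∀ v → Walk v v (v ∷ []) []
    step : ∀ {u v w vs es} ℓ → Edge ℓ → InEdge ℓ u → InEdge ℓ v →
           Walk v w vs es → Walk u w (u ∷ vs) (ℓ ∷ es)

  Path : ℕ → ℕ → Set
  Path u w = Σ (List ℕ) λ vs → Σ (List ℕ) λ es →
             Walk u w vs es × Unique vs × Unique es

  Connected : Set
  Connected = ∀ u w → Vertex n u → Vertex n w → Path u w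

  IsEdge : (ℕ → Set) → Set
  IsEdge X = Σ ℕ λ ℓ → Edge ℓ × (∀ x → X x ⇔ InEdge ℓ x)

  Ins : List ℕ → ℕ → ℕ → Set
  Ins S u x = x ∈ S ⊎ x ≡ u

  Forces : (ℕ → Set) → List ℕ → ℕ → Set
  Forces B S w =
    Unique S × length S ≡ d ∸ 1 × ¬ B w × IsEdge (Ins S w) ×
    (∀ u → ¬ B u → IsEdge (Ins S u) → u ≡ w)

  data Step : (ℕ → Set) → (ℕ → Set) → Set₁ where
    force : ∀ {B} S w → Forces B S w → Step B (λ x → B x ⊎ x ≡ w)

  ZeroForcingSet : (ℕ → Set) → Set₁
  ZeroForcingSet B = Σ (ℕ → Set) λ B' → Star Step B B' × (∀ x → Vertex n x → B' x)

{-# OPTIONS --safe #-}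
-- A blue block [a, b) of at least d consecutive vertices grows by one vertex at either
-- end until it is all of [n]. To add b, connectivity supplies an edge e containing
-- b - 1 and b, and the d - 1 other vertices of e force b: if (e ∖ {b}) ∪ {u} is an edge
-- with u ≠ b, then, as d ≥ 2, b is an end of e and u lies just beyond the other end;
-- since b - 1 ∈ e that end is the lower one, so u = b - d is already blue.
-- Adding a - 1 on the left is symmetric.
module Submission where

open import Data.Nat using (ℕ; zero; suc; pred; _+_; _∸_; _≤_; _<_; z≤n; s≤s; s≤s⁻¹; z<s; _≟_; _≤?_)
open import Data.Nat.Properties
open import Data.List using (List; _++_; length; applyUpTo)
open import Data.List.Properties using (length-++; length-applyUpTo)
open import Data.List.Membership.Propositional using (_∈_)
open import Data.List.Membership.Propositional.Properties using (∈-applyUpTo⁺; ∈-applyUpTo⁻; ∈-++⁺ˡ; ∈-++⁺ʳ; ∈-++⁻)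
open import Data.List.Relation.Unary.Unique.Propositional using (Unique)
open import Data.List.Relation.Unary.Unique.Propositional.Properties using (applyUpTo⁺₁; ++⁺)
open import Data.Product using (∃; _×_; _,_; proj₁; proj₂)
open import Data.Sum using (_⊎_; inj₁; inj₂)
open import Data.Sum.Function.Propositional using (_⊎-⇔_)
open import Data.Empty using (⊥-elim)
open import Function using (id; _∘_; case_of_)
open import Function.Bundles using (_⇔_; mk⇔; module Equivalence)
open import Function.Construct.Composition using (_⇔-∘_)
open import Function.Construct.Symmetry using (⇔-sym)
open import Function.Construct.Identity using (⇔-id)
open import Relation.Nullary using (¬_; yes; no)
open import Relation.Nullary.Decidable using (decidable-stable)
open import Relation.Binary.PropositionalEquality
open import Relation.Binary.Definitions using (tri<; tri≈; tri>)
open import Relation.Binary.Construct.Closure.ReflexiveTransitive using (Star; ε; _◅_; _◅◅_)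

open import Defs

open Equivalence using (to; from)

segment : ℕ → ℕ → List ℕ
segment a b = applyUpTo (a +_) (b ∸ a)

module _ {a b : ℕ} (a≤b : a ≤ b) where

  ∈-segment : ∀ {x} → x ∈ segment a b ⇔ (a ≤ x × x < b)
  ∈-segment {x} = mk⇔ ∈⇒ ⇒∈
    where
    ∈⇒ : x ∈ segment a b → a ≤ x × x < b
    ∈⇒ x∈ with i , i<b∸a , refl ← ∈-applyUpTo⁻ (a +_) x∈ =
      m≤m+n a i , subst (a + i <_) (m+[n∸m]≡n a≤b) (+-monoʳ-< a i<b∸a)
    ⇒∈ : a ≤ x × x < b → x ∈ segment a b
    ⇒∈ (a≤x , x<b) = subst (_∈ segment a b) (m+[n∸m]≡n a≤x)
                       (∈-applyUpTo⁺ (a +_) (∸-monoˡ-< x<b a≤x))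

segment-unique : ∀ a b → Unique (segment a b)
segment-unique a b = applyUpTo⁺₁ (a +_) (b ∸ a) (λ i<j _ → <⇒≢ (+-monoʳ-< a i<j))

punctured : ℕ → ℕ → ℕ → List ℕ
punctured d ℓ w = segment ℓ w ++ segment (suc w) (ℓ + d)

module Punctured {d ℓ w : ℕ} (ℓ≤w : ℓ ≤ w) (w<ℓ+d : w < ℓ + d) where

  ∈-punctured : ∀ {x} → x ∈ punctured d ℓ w ⇔ (Interval d ℓ x × x ≢ w)
  ∈-punctured {x} = mk⇔ ∈⇒ ⇒∈
    where
    ∈⇒ : x ∈ punctured d ℓ w → Interval d ℓ x × x ≢ w
    ∈⇒ x∈ with ∈-++⁻ (segment ℓ w) x∈
    ... | inj₁ x∈ˡ = let ℓ≤x , x<w = to (∈-segment ℓ≤w) x∈ˡ in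
                     (ℓ≤x , <-trans x<w w<ℓ+d) , <⇒≢ x<w
    ... | inj₂ x∈ʳ = let w<x , x<ℓ+d = to (∈-segment w<ℓ+d) x∈ʳ in
                     (≤-trans ℓ≤w (<⇒≤ w<x) , x<ℓ+d) , >⇒≢ w<x
    ⇒∈ : Interval d ℓ x × x ≢ w → x ∈ punctured d ℓ w
    ⇒∈ ((ℓ≤x , x<ℓ+d) , x≢w) with <-cmp x w
    ... | tri< x<w _ _ = ∈-++⁺ˡ (from (∈-segment ℓ≤w) (ℓ≤x , x<w))
    ... | tri≈ _ x≡w _ = ⊥-elim (x≢w x≡w)
    ... | tri> _ _ w<x = ∈-++⁺ʳ (segment ℓ w) (from (∈-segment w<ℓ+d) (w<x , x<ℓ+d))

  punctured-unique : Unique (punctured d ℓ w)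
  punctured-unique = ++⁺ (segment-unique ℓ w) (segment-unique (suc w) (ℓ + d)) disjoint
    where
    disjoint : ∀ {x} → ¬ (x ∈ segment ℓ w × x ∈ segment (suc w) (ℓ + d))
    disjoint (x∈ˡ , x∈ʳ) =
      <-asym (proj₂ (to (∈-segment ℓ≤w) x∈ˡ)) (proj₁ (to (∈-segment w<ℓ+d) x∈ʳ))

  length-punctured : length (punctured d ℓ w) ≡ d ∸ 1
  length-punctured = begin
    length (punctured d ℓ w)        ≡⟨ length-++ (segment ℓ w) ⟩
    length (segment ℓ w) + length (segment (suc w) (ℓ + d))
                                    ≡⟨ cong₂ _+_ (length-applyUpTo _ p) (length-applyUpTo _ q) ⟩
    p + q                           ≡⟨ cong pred (+-cancelˡ-≡ ℓ (suc (p + q)) d ℓ+[1+p+q]≡ℓ+d) ⟩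
    d ∸ 1                           ∎
    where
    open ≡-Reasoning
    p = w ∸ ℓ
    q = ℓ + d ∸ suc w
    ℓ+[1+p+q]≡ℓ+d : ℓ + suc (p + q) ≡ ℓ + d
    ℓ+[1+p+q]≡ℓ+d = begin
      ℓ + suc (p + q)  ≡⟨ +-suc ℓ (p + q) ⟩
      suc (ℓ + (p + q)) ≡⟨ cong suc (+-assoc ℓ p q) ⟨
      suc (ℓ + p + q)  ≡⟨ cong (λ v → suc v + q) (m+[n∸m]≡n ℓ≤w) ⟩
      suc w + q        ≡⟨ m+[n∸m]≡n w<ℓ+d ⟩
      ℓ + d            ∎

+-suc-<⇒≤ : ∀ {m n} k → m + k < n + suc k → m ≤ n
+-suc-<⇒≤ {m} {n} k m+k<n+1+k =
  +-cancelʳ-≤ k m n (s≤s⁻¹ (subst (m + k <_) (+-suc n k) m+k<n+1+k))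

-- w is an end of [ℓ, ℓ+d) and u is the vertex just beyond its other end.
EndpointSwap : ℕ → ℕ → ℕ → ℕ → Set
EndpointSwap d ℓ w u = (suc w ≡ ℓ + d × suc u ≡ ℓ) ⊎ (w ≡ ℓ × u ≡ ℓ + d)

module IntervalExchange {e ℓ ℓ′ w u : ℕ} (w∈ : Interval (2 + e) ℓ w) (u≢w : u ≢ w)
  (exchange : ∀ x → ((Interval (2 + e) ℓ x × x ≢ w) ⊎ x ≡ u) ⇔ Interval (2 + e) ℓ′ x) where

  d : ℕ
  d = 2 + e

  kept : ∀ {x} → Interval d ℓ x → x ≢ w → Interval d ℓ′ x
  kept x∈ x≢w = to (exchange _) (inj₁ (x∈ , x≢w))

  added : ∀ {x} → Interval d ℓ′ x → ¬ Interval d ℓ x → x ≡ u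
  added {x} x∈′ x∉ with from (exchange x) x∈′
  ... | inj₁ (x∈ , _) = ⊥-elim (x∉ x∈)
  ... | inj₂ x≡u = x≡u

  ℓ′≢ℓ : ℓ′ ≢ ℓ
  ℓ′≢ℓ ℓ′≡ℓ with from (exchange w) (subst (λ m → Interval d m w) (sym ℓ′≡ℓ) w∈)
  ... | inj₁ (_ , w≢w) = w≢w refl
  ... | inj₂ w≡u = u≢w (sym w≡u)

  -- The top ℓ+d-1 lies outside a lower interval, so it must be w; the kept vertex
  -- ℓ+d-2 then pins ℓ′ to ℓ-1.
  below⇒swap : ℓ′ < ℓ → suc w ≡ ℓ + d × suc u ≡ ℓ
  below⇒swap ℓ′<ℓ = trans (cong suc w≡top) (sym (+-suc ℓ (suc e))) ,
                    trans (cong suc (sym ℓ′≡u)) (sym ℓ≡1+ℓ′)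
    where
    w≡top : w ≡ ℓ + suc e
    w≡top = decidable-stable (w ≟ ℓ + suc e) λ w≢top →
      <⇒≱ ℓ′<ℓ (+-suc-<⇒≤ (suc e) (proj₂ (kept (m≤m+n ℓ _ , +-monoʳ-< ℓ ≤-refl) (w≢top ∘ sym))))
    below-top<w : ℓ + e < w
    below-top<w = subst (ℓ + e <_) (sym w≡top) (+-monoʳ-< ℓ ≤-refl)
    ℓ≡1+ℓ′ : ℓ ≡ suc ℓ′
    ℓ≡1+ℓ′ = ≤-antisym (+-suc-<⇒≤ e (subst (ℓ + e <_) (+-suc ℓ′ (suc e)) (proj₂ below-top∈′))) ℓ′<ℓ
      where
      below-top∈′ : Interval d ℓ′ (ℓ + e)
      below-top∈′ = kept (m≤m+n ℓ e , <-trans below-top<w (proj₂ w∈)) (<⇒≢ below-top<w)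
    ℓ′≡u : ℓ′ ≡ u
    ℓ′≡u = added (≤-refl , m<m+n ℓ′ z<s) (λ (ℓ≤ℓ′ , _) → <⇒≱ ℓ′<ℓ ℓ≤ℓ′)

  -- Symmetrically ℓ must be w, and the kept vertex ℓ+1 pins ℓ′ to ℓ+1.
  above⇒swap : ℓ < ℓ′ → w ≡ ℓ × u ≡ ℓ + d
  above⇒swap ℓ<ℓ′ = w≡ℓ , sym ℓ+d≡u
    where
    w≡ℓ : w ≡ ℓ
    w≡ℓ = decidable-stable (w ≟ ℓ) λ w≢ℓ →
      <⇒≱ ℓ<ℓ′ (proj₁ (kept (≤-refl , m<m+n ℓ z<s) (w≢ℓ ∘ sym)))
    1+ℓ<ℓ+d : suc ℓ < ℓ + d
    1+ℓ<ℓ+d = subst (suc ℓ <_) (sym (trans (+-suc ℓ (suc e)) (cong suc (+-suc ℓ e))))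
                    (s≤s (s≤s (m≤m+n ℓ e)))
    ℓ′≤1+ℓ : ℓ′ ≤ suc ℓ
    ℓ′≤1+ℓ = proj₁ (kept (n≤1+n ℓ , 1+ℓ<ℓ+d) (λ 1+ℓ≡w → 1+n≢n (trans 1+ℓ≡w w≡ℓ)))
    ℓ+d≡u : ℓ + d ≡ u
    ℓ+d≡u = added (≤-trans ℓ′≤1+ℓ (<⇒≤ 1+ℓ<ℓ+d) , +-monoˡ-< d ℓ<ℓ′)
                  (λ (_ , ℓ+d<ℓ+d) → <-irrefl refl ℓ+d<ℓ+d)

interval-exchange : ∀ {d ℓ ℓ′ w u} → 2 ≤ d → Interval d ℓ w → u ≢ w →
  (∀ x → ((Interval d ℓ x × x ≢ w) ⊎ x ≡ u) ⇔ Interval d ℓ′ x) →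
  EndpointSwap d ℓ w u
interval-exchange {ℓ = ℓ} {ℓ′} (s≤s (s≤s z≤n)) w∈ u≢w exchange = case <-cmp ℓ′ ℓ of λ where
    (tri< ℓ′<ℓ _ _) → inj₁ (below⇒swap ℓ′<ℓ)
    (tri≈ _ ℓ′≡ℓ _) → ⊥-elim (ℓ′≢ℓ ℓ′≡ℓ)
    (tri> _ _ ℓ<ℓ′) → inj₂ (above⇒swap ℓ<ℓ′)
  where open IntervalExchange w∈ u≢w exchange

IsSegment : (ℕ → Set) → ℕ → ℕ → Set
IsSegment B a b = ∀ x → B x ⇔ (a ≤ x × x < b)

IsSegment-extendʳ : ∀ {B a b} → IsSegment B a b → a ≤ b → IsSegment (λ x → B x ⊎ x ≡ b) a (suc b)
IsSegment-extendʳ {B} {a} {b} seg a≤b x = mk⇔ ⇒∈ ∈⇒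
  where
  ⇒∈ : B x ⊎ x ≡ b → a ≤ x × x < suc b
  ⇒∈ (inj₁ Bx) = let a≤x , x<b = to (seg x) Bx in a≤x , m<n⇒m<1+n x<b
  ⇒∈ (inj₂ refl) = a≤b , n<1+n b
  ∈⇒ : a ≤ x × x < suc b → B x ⊎ x ≡ b
  ∈⇒ (a≤x , x<1+b) with m≤n⇒m<n∨m≡n (s≤s⁻¹ x<1+b)
  ... | inj₁ x<b = inj₁ (from (seg x) (a≤x , x<b))
  ... | inj₂ x≡b = inj₂ x≡b

IsSegment-extendˡ : ∀ {B a b} → IsSegment B (suc a) b → a < b → IsSegment (λ x → B x ⊎ x ≡ a) a b
IsSegment-extendˡ {B} {a} {b} seg a<b x = mk⇔ ⇒∈ ∈⇒
  where
  ⇒∈ : B x ⊎ x ≡ a → a ≤ x × x < b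
  ⇒∈ (inj₁ Bx) = let a<x , x<b = to (seg x) Bx in <⇒≤ a<x , x<b
  ⇒∈ (inj₂ refl) = ≤-refl , a<b
  ∈⇒ : a ≤ x × x < b → B x ⊎ x ≡ a
  ∈⇒ (a≤x , x<b) with m≤n⇒m<n∨m≡n a≤x
  ... | inj₁ a<x = inj₁ (from (seg x) (a<x , x<b))
  ... | inj₂ a≡x = inj₂ (sym a≡x)

module _ (H : IntervalHypergraph) where
  open IntervalHypergraph H

  walk-crossing-edge : ∀ {u w vs es} c → Walk H u w vs es → u ≤ c → c < w →
    ∃ λ ℓ → Edge ℓ × InEdge H ℓ c × InEdge H ℓ (suc c)
  walk-crossing-edge c (here _) u≤c c<u = ⊥-elim (<⇒≱ c<u u≤c)
  walk-crossing-edge c (step {v = v} ℓ eℓ (ℓ≤u , _) (_ , v<ℓ+d) walk) u≤c c<w with v ≤? c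
  ... | yes v≤c = walk-crossing-edge c walk v≤c c<w
  ... | no v≰c = ℓ , eℓ , (ℓ≤c , <-trans c<v v<ℓ+d) , (m≤n⇒m≤1+n ℓ≤c , ≤-<-trans c<v v<ℓ+d)
    where
    ℓ≤c = ≤-trans ℓ≤u u≤c
    c<v = ≰⇒> v≰c

  crossing-edge : Connected H → ∀ c → 1 ≤ c → suc c ≤ n →
    ∃ λ ℓ → Edge ℓ × InEdge H ℓ c × InEdge H ℓ (suc c)
  crossing-edge conn c 1≤c 1+c≤n =
    let _ , _ , walk , _ = conn c (suc c) (1≤c , <⇒≤ 1+c≤n) (z<s , 1+c≤n) in
    walk-crossing-edge c walk ≤-refl (n<1+n c)

module Forcing (H : IntervalHypergraph) (2≤d : 2 ≤ IntervalHypergraph.d H) (conn : Connected H) where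
  open IntervalHypergraph H

  0<d : 0 < d
  0<d = ≤-trans (s≤s z≤n) 2≤d

  forces-punctured : ∀ {B ℓ w} → Edge ℓ → InEdge H ℓ w → ¬ B w →
    (∀ {u} → EndpointSwap d ℓ w u → B u) → Forces H B (punctured d ℓ w) w
  forces-punctured {B} {ℓ} {w} eℓ w∈ ¬Bw swap⇒blue =
    punctured-unique , length-punctured , ¬Bw , (ℓ , eℓ , λ x → mk⇔ ⇒∈ (∈⇒ x)) , only-w
    where
    open Punctured (proj₁ w∈) (proj₂ w∈)
    ⇒∈ : ∀ {x} → Ins H (punctured d ℓ w) w x → InEdge H ℓ x
    ⇒∈ (inj₁ x∈) = proj₁ (to ∈-punctured x∈)
    ⇒∈ (inj₂ refl) = w∈
    ∈⇒ : ∀ x → InEdge H ℓ x → Ins H (punctured d ℓ w) w x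
    ∈⇒ x x∈ with x ≟ w
    ... | yes x≡w = inj₂ x≡w
    ... | no x≢w = inj₁ (from ∈-punctured (x∈ , x≢w))
    only-w : ∀ u → ¬ B u → IsEdge H (Ins H (punctured d ℓ w) u) → u ≡ w
    only-w u ¬Bu (ℓ′ , _ , ins≡edge) = decidable-stable (u ≟ w) λ u≢w →
      ¬Bu (swap⇒blue (interval-exchange 2≤d w∈ u≢w λ x →
        ins≡edge x ⇔-∘ (⇔-sym ∈-punctured ⊎-⇔ ⇔-id _)))

  force-right : ∀ {B a b} → IsSegment B a (suc b) → a + d ≤ suc b → suc b ≤ n →
    Step H B (λ x → B x ⊎ x ≡ suc b)
  force-right {B} {a} {b} seg a+d≤1+b 1+b≤n
    with crossing-edge H conn b (s≤s⁻¹ (≤-trans 2≤d (≤-trans (m≤n+m d a) a+d≤1+b))) 1+b≤n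
  ... | ℓ , eℓ , (ℓ≤b , _) , 1+b∈ =
    force _ _ (forces-punctured eℓ 1+b∈ (λ B[1+b] → <-irrefl refl (proj₂ (to (seg _) B[1+b]))) swap⇒blue)
    where
    swap⇒blue : ∀ {u} → EndpointSwap d ℓ (suc b) u → B u
    swap⇒blue {u} (inj₁ (2+b≡ℓ+d , 1+u≡ℓ)) =
      from (seg u) (+-cancelʳ-≤ d a u (subst (a + d ≤_) 1+b≡u+d a+d≤1+b) ,
                    m<n⇒m<1+n (subst (_≤ b) (sym 1+u≡ℓ) ℓ≤b))
      where
      1+b≡u+d : suc b ≡ u + d
      1+b≡u+d = cong pred (trans 2+b≡ℓ+d (cong (_+ d) (sym 1+u≡ℓ)))
    swap⇒blue (inj₂ (1+b≡ℓ , _)) = ⊥-elim (<-irrefl (sym 1+b≡ℓ) (s≤s ℓ≤b))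

  force-left : ∀ {B a b} → IsSegment B (suc a) b → suc a + d ≤ b → b ≤ suc n → 1 ≤ a →
    Step H B (λ x → B x ⊎ x ≡ a)
  force-left {B} {a} {b} seg 1+a+d≤b b≤1+n 1≤a
    with crossing-edge H conn a 1≤a (s≤s⁻¹ (≤-trans (m<m+n (suc a) 0<d) (≤-trans 1+a+d≤b b≤1+n)))
  ... | ℓ , eℓ , a∈ , (_ , 1+a<ℓ+d) =
    force _ _ (forces-punctured eℓ a∈ (λ Ba → <-irrefl refl (proj₁ (to (seg _) Ba))) swap⇒blue)
    where
    swap⇒blue : ∀ {u} → EndpointSwap d ℓ a u → B u
    swap⇒blue (inj₁ (1+a≡ℓ+d , _)) = ⊥-elim (<-irrefl 1+a≡ℓ+d 1+a<ℓ+d)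
    swap⇒blue {u} (inj₂ (refl , refl)) = from (seg u) (m<m+n a 0<d , 1+a+d≤b)

  Reaches : (ℕ → Set) → ℕ → ℕ → Set₁
  Reaches B a b = ∃ λ B′ → Star (Step H) B B′ × IsSegment B′ a b

  grow-right : ∀ m {B a b} → IsSegment B a (suc b) → a + d ≤ suc b → b + m ≡ n → Reaches B a (suc n)
  grow-right zero {B} {a} {b} seg _ b+0≡n =
    B , ε , subst (λ c → IsSegment B a (suc c)) (trans (sym (+-identityʳ b)) b+0≡n) seg
  grow-right (suc m) {a = a} {b} seg a+d≤1+b b+1+m≡n =
    let B′ , steps , seg′ = grow-right m (IsSegment-extendʳ seg (≤-trans (m≤m+n a d) a+d≤1+b))
                              (m≤n⇒m≤1+n a+d≤1+b) (trans (sym (+-suc b m)) b+1+m≡n)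
    in B′ , force-right seg a+d≤1+b (subst (suc b ≤_) b+1+m≡n (m<m+n b z<s)) ◅ steps , seg′

  grow-left : ∀ a {B b} → IsSegment B (suc a) b → suc a + d ≤ b → b ≤ suc n → Reaches B 1 b
  grow-left zero {B} seg _ _ = B , ε , seg
  grow-left (suc a) seg 2+a+d≤b b≤1+n =
    let B′ , steps , seg′ = grow-left a (IsSegment-extendˡ seg (≤-trans (m≤m+n (suc (suc a)) d) 2+a+d≤b))
                              (≤-trans (n≤1+n _) 2+a+d≤b) b≤1+n
    in B′ , force-left seg 2+a+d≤b b≤1+n z<s ◅ steps , seg′

lemma3p9 : (H : IntervalHypergraph) → 2 ≤ IntervalHypergraph.d H → Connected H →
    ∀ k → 1 ≤ k → k + IntervalHypergraph.d H ∸ 1 ≤ IntervalHypergraph.n H →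
    ZeroForcingSet H (Interval (IntervalHypergraph.d H) k)
lemma3p9 H 2≤d conn (suc k) _ k+d≤n =
  let B₁ , steps₁ , seg₁ = grow-right (n ∸ (k + d)) (λ _ → mk⇔ id id) ≤-refl (m+[n∸m]≡n k+d≤n)
      B₂ , steps₂ , seg₂ = grow-left k seg₁ (s≤s k+d≤n) ≤-refl
  in B₂ , steps₁ ◅◅ steps₂ , λ x (1≤x , x≤n) → from (seg₂ x) (1≤x , s≤s x≤n)
  where
  open IntervalHypergraph H
  open Forcing H 2≤d conn
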